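{- Let $S$ be a Steiner triple system of order $n$ and let $S'$ be a subset of $S$ with $\emptyset\ne S'\ne S$. Then $S'$ is a completely regular code in the block graph $\Gamma_S$ with covering radius $\rho=1$ and eigenvalue $\theta_2(\Gamma_S)$ if and only if $S'$ is a $1$-design, i.e. every point of $\{1,\dots,n\}$ lies in the same number $\lambda$ of blocks of $S'$.
   Context: A Steiner triple system (STS) of order $n$ is a collection $S$ of $3$-subsets (blocks) of $\{1,\dots,n\}$ such that each $2$-subset lies in exactly one block. The block graph $\Gamma_S$ has the blocks as vertices, two distinct blocks adjacent iff they intersect; it is strongly regular with eigenvalues $\theta_0>\theta_1>\theta_2=-3$. For $C\subseteq V(\Gamma)$ let $C_i=\{x:d(x,C)=i\}$ and $\rho$ the largest $i$ with $C_i\neq\emptyset$. $C$ is a completely regular code if there are numbers $\alpha_i,\beta_i,\gamma_i$ such that every vertex of $C_i$ has exactly $\alpha_i,\beta_i,\gamma_i$ neighbours in $C_i,C_{i+1},C_{i-1}$ respectively; its eigenvalues are the eigenvalues of the tridiagonal matrix with diagonal $\alpha_0,\dots,\alpha_\rho$, superdiagonal $\beta_0,\dots,\beta_{\rho-1}$, subdiagonal $\gamma_1,\dots,\gamma_\rho$. -}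

module Defs where

open import Data.Nat using (ℕ; _≤ᵇ_)
open import Data.Integer as ℤ using (ℤ; +_; -[1+_])
open import Data.Bool using (Bool; true; false; _∧_; not)
open import Data.Fin using (Fin; _≟_)
open import Data.Fin.Subset using (Subset; _∩_; ∣_∣; ∁; _∈_; _∉_; inside)
open import Data.Vec using (lookup; tabulate)
open import Data.Product using (Σ; ∃; _×_)
open import Function.Definitions using (Injective)
open import Relation.Binary.PropositionalEquality using (_≡_; _≢_)
open import Relation.Nullary.Decidable using (⌊_⌋)

pairCount : ∀ {n m} → (Fin m → Subset n) → Fin n → Fin n → ℕ
pairCount B x y = ∣ tabulate (λ i → lookup (B i) x ∧ lookup (B i) y) ∣

-- B is (an enumeration without repetition of) a Steiner triple system of order n
record IsSTS {n m : ℕ} (B : Fin m → Subset n) : Set where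
  field
    distinct   : Injective _≡_ _≡_ B
    triples    : ∀ i → ∣ B i ∣ ≡ 3
    pairsOnce  : ∀ x y → x ≢ y → pairCount B x y ≡ 1

adj : ∀ {n m} → (Fin m → Subset n) → Fin m → Fin m → Bool
adj B i j = not ⌊ i ≟ j ⌋ ∧ (1 ≤ᵇ ∣ B i ∩ B j ∣)

N : ∀ {n m} → (Fin m → Subset n) → Fin m → Subset m
N B i = tabulate (adj B i)

-- C is a completely regular code in Γ_S with covering radius ρ = 1 and
-- intersection numbers α₀ β₀ (on C₀ = C) and γ₁ α₁ (on C₁), β₁ = 0.
-- With ρ = 1 every vertex outside C lies at distance exactly 1 from C.
record IsCRC₁ {n m : ℕ} (B : Fin m → Subset n) (C : Subset m)
              (α₀ β₀ γ₁ α₁ : ℕ) : Set where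
  field
    C₁-nonempty : ∃ λ v → v ∉ C
    C₁-dist1    : ∀ v → v ∉ C → ∃ λ u → u ∈ C × adj B v u ≡ true
    α₀-ok : ∀ v → v ∈ C → ∣ N B v ∩ C ∣ ≡ α₀
    β₀-ok : ∀ v → v ∈ C → ∣ N B v ∩ ∁ C ∣ ≡ β₀
    γ₁-ok : ∀ v → v ∉ C → ∣ N B v ∩ C ∣ ≡ γ₁
    α₁-ok : ∀ v → v ∉ C → ∣ N B v ∩ ∁ C ∣ ≡ α₁

Eigenvalue₂ : ℤ → ℤ → ℤ → ℤ → ℤ → Set
Eigenvalue₂ a b c d θ = (a ℤ.- θ) ℤ.* (d ℤ.- θ) ℤ.- b ℤ.* c ≡ + 0

θ₂ : ℤ
θ₂ = -[1+ 2 ]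

-- completely regular with ρ = 1 and eigenvalue θ: the tridiagonal
-- quotient matrix [[α₀ , β₀] , [γ₁ , α₁]] has eigenvalue θ
CRC₁WithEigenvalue : ∀ {n m} → (Fin m → Subset n) → Subset m → ℤ → Set
CRC₁WithEigenvalue B C θ =
  Σ ℕ λ α₀ → Σ ℕ λ β₀ → Σ ℕ λ γ₁ → Σ ℕ λ α₁ →
    IsCRC₁ B C α₀ β₀ γ₁ α₁ × Eigenvalue₂ (+ α₀) (+ β₀) (+ γ₁) (+ α₁) θ

OneDesign : ∀ {n m} → (Fin m → Subset n) → Subset m → Set
OneDesign {n} B C = Σ ℕ λ lam → ∀ (x : Fin n) →
  ∣ tabulate (λ i → lookup C i ∧ lookup (B i) x) ∣ ≡ lam

module Submission where

-- Let deg_D x be the number of blocks of D through the point x. Two distinct blocks of a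
-- Steiner triple system meet in at most one point, so a block v satisfies
-- |N(v) ∩ D| + 3·[v ∈ D] = Σ_{x ∈ v} deg_D x. If C is a 1-design these block sums are
-- constant for D = C and D = ∁C; this gives the intersection numbers, and
-- (α₀ + 3)(α₁ + 3) = β₀γ₁ is exactly the statement that −3 is an eigenvalue. Conversely the
-- quotient matrix has both row sums equal to 3r, so the eigenvalue −3 forces α₀ + 3 = γ₁
-- and the block sums of deg_C are constant, say s. Counting over the blocks through x,
-- using that every pair of points lies in exactly one block, gives
-- (r − 1)·deg_C x + Σ_y deg_C y = r·s, and r ≥ 2 as soon as there are two blocks.

open import Defs
open import Data.Nat using (ℕ)
open import Data.Fin using (Fin)
open import Data.Fin.Subset using (Subset; Nonempty; ⊤)
open import Function.Bundles using (_⇔_)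
open import Relation.Binary.PropositionalEquality using (_≢_)

open import Data.Bool using (Bool; true; false; _∧_; not)
open import Data.Bool.Properties using (∧-conicalˡ; ∧-conicalʳ)
open import Data.Fin using (zero; suc; _≟_)
import Data.Fin.Properties as Fin
open import Data.Fin.Subset using (_∩_; ∣_∣; ∁; _∈_; _∉_)
open import Data.Fin.Subset.Properties
  using ( _∈?_; nonempty?; Empty-unique; ∣⊥∣≡0; ∣p∣≤n; ∣p∣≡n⇒p≡⊤; ⊆-antisym; ⊆⊤
        ; x∈p⇒x∉∁p; x∉p⇒x∈∁p; x∈∁p⇒x∉p; x∉∁p⇒x∈p; x∈p∩q⁻)
import Data.Integer as ℤ
import Data.Integer.Properties as ℤ
open import Data.Nat using (zero; suc; _+_; _*_; _≤_; _<_; _≤ᵇ_; z≤n; s≤s; >-nonZero)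
open import Data.Nat.Properties hiding (_≟_)
open import Data.Nat.Tactic.RingSolver using (solve-∀)
open import Algebra.Properties.Semiring.Sum +-*-semiring
  using (sum; sum-syntax; sum-cong-≗; sum-replicate-zero; ∑-comm; ∑-distrib-+; *-distribˡ-sum; *-distribʳ-sum)
open import Data.Product using (∃; _×_; _,_; proj₁; proj₂)
open import Data.Vec using ([]; _∷_; lookup; tabulate)
open import Data.Vec.Properties using (lookup∘tabulate; lookup-zipWith; lookup-map; []=⇒lookup; lookup⇒[]=)
open import Function using (_∘_)
open import Function.Bundles using (mk⇔; Equivalence)
open import Relation.Nullary using (¬_; yes; no; contradiction)
open import Relation.Binary.PropositionalEquality
  using (_≡_; refl; sym; trans; cong; cong₂; subst; subst₂; module ≡-Reasoning)

𝟙[_] : Bool → ℕ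
𝟙[ true ]  = 1
𝟙[ false ] = 0

𝟙-∧ : ∀ a b → 𝟙[ a ∧ b ] ≡ 𝟙[ a ] * 𝟙[ b ]
𝟙-∧ true  b = sym (*-identityˡ 𝟙[ b ])
𝟙-∧ false b = refl

𝟙-idem : ∀ a → 𝟙[ a ] * 𝟙[ a ] ≡ 𝟙[ a ]
𝟙-idem true  = refl
𝟙-idem false = refl

𝟙-≤ᵇ : ∀ {k} → k ≤ 1 → 𝟙[ 1 ≤ᵇ k ] ≡ k
𝟙-≤ᵇ z≤n       = refl
𝟙-≤ᵇ (s≤s z≤n) = refl

∑-one : ∀ k → ∑[ i < k ] 1 ≡ k
∑-one zero    = refl
∑-one (suc k) = cong suc (∑-one k)

≤∑ : ∀ {k} (f : Fin k → ℕ) i → f i ≤ sum f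
≤∑ f zero    = m≤m+n (f zero) _
≤∑ f (suc i) = ≤-trans (≤∑ (f ∘ suc) i) (m≤n+m _ (f zero))

pair≤∑ : ∀ {k} (f : Fin k → ℕ) {i j} → i ≢ j → f i + f j ≤ sum f
pair≤∑ f {zero}  {zero}  i≢j = contradiction refl i≢j
pair≤∑ f {zero}  {suc j} _   = +-monoʳ-≤ (f zero) (≤∑ (f ∘ suc) j)
pair≤∑ f {suc i} {zero}  _   =
  subst (_≤ sum f) (+-comm (f zero) (f (suc i))) (+-monoʳ-≤ (f zero) (≤∑ (f ∘ suc) i))
pair≤∑ f {suc i} {suc j} i≢j = ≤-trans (pair≤∑ (f ∘ suc) (i≢j ∘ cong suc)) (m≤n+m _ (f zero))

∑𝟙≤1 : ∀ {k} (p : Fin k → Bool) → (∀ {i j} → p i ≡ true → p j ≡ true → i ≡ j) →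
  ∑[ i < k ] 𝟙[ p i ] ≤ 1
∑𝟙≤1 {zero}  p unique = z≤n
∑𝟙≤1 {suc k} p unique with p zero in p₀
... | false = ∑𝟙≤1 (p ∘ suc) (λ pᵢ pⱼ → Fin.suc-injective (unique pᵢ pⱼ))
... | true  = s≤s (≤-reflexive (trans (sum-cong-≗ rest-empty) (sum-replicate-zero k)))
  where
  rest-empty : ∀ i → 𝟙[ p (suc i) ] ≡ 0
  rest-empty i with p (suc i) in pᵢ
  ... | true  = contradiction (unique p₀ pᵢ) λ ()
  ... | false = refl

∑-agreeExcept : ∀ {k} {g h : Fin k → ℕ} i → (∀ j → j ≢ i → g j ≡ h j) →
  sum g + h i ≡ sum h + g i
∑-agreeExcept {suc k} {g} {h} zero agree = begin
  g zero + sum (g ∘ suc) + h zero ≡⟨ cong (λ t → g zero + t + h zero) (sum-cong-≗ λ j → agree (suc j) λ ()) ⟩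
  g zero + sum (h ∘ suc) + h zero ≡⟨ swap (g zero) (sum (h ∘ suc)) (h zero) ⟩
  h zero + sum (h ∘ suc) + g zero ∎
  where
  open ≡-Reasoning
  swap : ∀ a b c → a + b + c ≡ c + b + a
  swap = solve-∀
∑-agreeExcept {suc k} {g} {h} (suc i) agree = begin
  g zero + sum (g ∘ suc) + h (suc i)   ≡⟨ +-assoc (g zero) _ _ ⟩
  g zero + (sum (g ∘ suc) + h (suc i)) ≡⟨ cong₂ _+_ (agree zero λ ()) (∑-agreeExcept i agree-tail) ⟩
  h zero + (sum (h ∘ suc) + g (suc i)) ≡⟨ +-assoc (h zero) _ _ ⟨
  h zero + sum (h ∘ suc) + g (suc i)   ∎
  where
  open ≡-Reasoning
  agree-tail : ∀ j → j ≢ i → g (suc j) ≡ h (suc j)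
  agree-tail j j≢i = agree (suc j) (j≢i ∘ Fin.suc-injective)

∑-transpose : ∀ {k l} (M : Fin k → Fin l → ℕ) (g : Fin k → ℕ) (f : Fin l → ℕ) →
  ∑[ j < l ] (f j * ∑[ i < k ] (g i * M i j)) ≡ ∑[ i < k ] (g i * ∑[ j < l ] (M i j * f j))
∑-transpose {k} {l} M g f = begin
  ∑[ j < l ] (f j * ∑[ i < k ] (g i * M i j))
    ≡⟨ sum-cong-≗ (λ j → *-distribˡ-sum (f j) (λ i → g i * M i j)) ⟩
  ∑[ j < l ] ∑[ i < k ] (f j * (g i * M i j))
    ≡⟨ sum-cong-≗ (λ j → sum-cong-≗ (λ i → rearrange (f j) (g i) (M i j))) ⟩
  ∑[ j < l ] ∑[ i < k ] (g i * (M i j * f j))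
    ≡⟨ ∑-comm (λ j i → g i * (M i j * f j)) ⟩
  ∑[ i < k ] ∑[ j < l ] (g i * (M i j * f j))
    ≡⟨ sum-cong-≗ (λ i → *-distribˡ-sum (g i) (λ j → M i j * f j)) ⟨
  ∑[ i < k ] (g i * ∑[ j < l ] (M i j * f j))
    ∎
  where
  open ≡-Reasoning
  rearrange : ∀ a b c → a * (b * c) ≡ b * (c * a)
  rearrange = solve-∀

∣p∣≡∑ : ∀ {k} (p : Subset k) → ∣ p ∣ ≡ ∑[ i < k ] 𝟙[ lookup p i ]
∣p∣≡∑ []          = refl
∣p∣≡∑ (true ∷ p)  = cong suc (∣p∣≡∑ p)
∣p∣≡∑ (false ∷ p) = ∣p∣≡∑ p

∣tabulate∣≡∑ : ∀ {k} (f : Fin k → Bool) → ∣ tabulate f ∣ ≡ ∑[ i < k ] 𝟙[ f i ]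
∣tabulate∣≡∑ f = trans (∣p∣≡∑ (tabulate f)) (sum-cong-≗ (cong 𝟙[_] ∘ lookup∘tabulate f))

∣p∩q∣≡∑ : ∀ {k} (p q : Subset k) → ∣ p ∩ q ∣ ≡ ∑[ i < k ] (𝟙[ lookup p i ] * 𝟙[ lookup q i ])
∣p∩q∣≡∑ p q = trans (∣p∣≡∑ (p ∩ q)) (sum-cong-≗ λ i →
  trans (cong 𝟙[_] (lookup-zipWith _∧_ i p q)) (𝟙-∧ (lookup p i) (lookup q i)))

x∉p⇒lookup≡false : ∀ {k} {p : Subset k} {x} → x ∉ p → lookup p x ≡ false
x∉p⇒lookup≡false {p = p} {x} x∉p with lookup p x in eq
... | true  = contradiction (lookup⇒[]= x p eq) x∉p
... | false = refl

1≤∣p∣⇒Nonempty : ∀ {k} (p : Subset k) → 1 ≤ ∣ p ∣ → Nonempty p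
1≤∣p∣⇒Nonempty {k} p 1≤∣p∣ with nonempty? p
... | yes p≠∅ = p≠∅
... | no  p=∅ =
  contradiction (subst (1 ≤_) (∣⊥∣≡0 k) (subst (λ q → 1 ≤ ∣ q ∣) (Empty-unique p=∅) 1≤∣p∣)) λ ()

p≢⊤⇒∃∉ : ∀ {k} {p : Subset k} → p ≢ ⊤ → ∃ λ x → x ∉ p
p≢⊤⇒∃∉ {p = p} p≢⊤ with nonempty? (∁ p)
... | yes (x , x∈∁p) = x , x∈∁p⇒x∉p x∈∁p
... | no  ∁p=∅       = contradiction (⊆-antisym ⊆⊤ (λ {x} _ → x∉∁p⇒x∈p λ x∈∁p → ∁p=∅ (x , x∈∁p))) p≢⊤

-- When both row sums equal K, the determinant a d − b c equals K (a − c).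
equal-row-sums : ∀ {a b c d} → 0 < a → a + b ≡ c + d → a * d ≡ b * c → a ≡ c
equal-row-sums {a} {b} {c} {d} 0<a rows det =
  *-cancelʳ-≡ a c (a + b) {{>-nonZero (<-≤-trans 0<a (m≤m+n a b))}} (begin
  a * (a + b)     ≡⟨ cong (a *_) rows ⟩
  a * (c + d)     ≡⟨ *-distribˡ-+ a c d ⟩
  a * c + a * d   ≡⟨ cong (a * c +_) det ⟩
  a * c + b * c   ≡⟨ *-distribʳ-+ c a b ⟨
  (a + b) * c     ≡⟨ *-comm (a + b) c ⟩
  c * (a + b)     ∎)
  where open ≡-Reasoning

affine-injective : ∀ {A T u w R} → 2 ≤ R → A + u ≡ T + u * R → A + w ≡ T + w * R → u ≡ w
affine-injective {A} {T} {u} {w} {suc (suc q)} (s≤s (s≤s _)) eu ew =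
  *-cancelʳ-≡ u w (suc q) (+-cancelˡ-≡ T _ _ (trans (sym (peel eu)) (peel ew)))
  where
  split : ∀ T v q → T + v * suc (suc q) ≡ T + v * suc q + v
  split = solve-∀
  peel : ∀ {v} → A + v ≡ T + v * suc (suc q) → A ≡ T + v * suc q
  peel {v} e = +-cancelʳ-≡ v _ _ (trans e (split T v q))

θ₂-eigenvalue⇔ : ∀ a b c d →
  Eigenvalue₂ (ℤ.+ a) (ℤ.+ b) (ℤ.+ c) (ℤ.+ d) θ₂ ⇔ (a + 3) * (d + 3) ≡ b * c
θ₂-eigenvalue⇔ a b c d = mk⇔
  (λ eig → ℤ.+-injective (trans (ℤ.pos-* (a + 3) (d + 3))
                         (trans (ℤ.i-j≡0⇒i≡j _ _ eig) (sym (ℤ.pos-* b c)))))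
  (λ det → ℤ.i≡j⇒i-j≡0 (trans (sym (ℤ.pos-* (a + 3) (d + 3)))
                        (trans (cong ℤ.+_ det) (ℤ.pos-* b c))))

Constant : ∀ {k} → (Fin k → ℕ) → Set
Constant f = ∀ i j → f i ≡ f j

module SteinerTripleSystem {n m : ℕ} (B : Fin m → Subset n) (sts : IsSTS B) where
  open IsSTS sts

  incidence : Fin m → Fin n → ℕ
  incidence v x = 𝟙[ lookup (B v) x ]

  replication : Fin n → ℕ
  replication x = ∑[ v < m ] incidence v x

  pairs : Fin n → Fin n → ℕ
  pairs x y = ∑[ v < m ] (incidence v x * incidence v y)

  meet : Fin m → Fin m → ℕ
  meet u v = ∑[ x < n ] (incidence u x * incidence v x)

  blockSum : (Fin n → ℕ) → Fin m → ℕ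
  blockSum f v = ∑[ y < n ] (incidence v y * f y)

  degree : Subset m → Fin n → ℕ
  degree D x = ∑[ u < m ] (𝟙[ lookup D u ] * incidence u x)

  blockSize : ∀ v → ∑[ x < n ] incidence v x ≡ 3
  blockSize v = trans (sym (∣p∣≡∑ (B v))) (triples v)

  pointOf : Fin m → Fin n
  pointOf v = proj₁ (1≤∣p∣⇒Nonempty (B v) (subst (1 ≤_) (sym (triples v)) (s≤s z≤n)))

  pairs-≢ : ∀ {x y} → x ≢ y → pairs x y ≡ 1
  pairs-≢ {x} {y} x≢y = begin
    pairs x y                ≡⟨ sum-cong-≗ (λ v → 𝟙-∧ (lookup (B v) x) (lookup (B v) y)) ⟨
    ∑[ v < m ] 𝟙[ both v ]   ≡⟨ ∣tabulate∣≡∑ both ⟨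
    pairCount B x y          ≡⟨ pairsOnce x y x≢y ⟩
    1                        ∎
    where
    open ≡-Reasoning
    both : Fin m → Bool
    both v = lookup (B v) x ∧ lookup (B v) y

  pairs-diag : ∀ x → pairs x x ≡ replication x
  pairs-diag x = sum-cong-≗ λ v → 𝟙-idem (lookup (B v) x)

  meet-diag : ∀ v → meet v v ≡ 3
  meet-diag v = trans (sum-cong-≗ λ x → 𝟙-idem (lookup (B v) x)) (blockSize v)

  meet-comm : ∀ u v → meet u v ≡ meet v u
  meet-comm u v = sum-cong-≗ λ x → *-comm (incidence u x) (incidence v x)

  meet≤1 : ∀ {u v} → u ≢ v → meet u v ≤ 1
  meet≤1 {u} {v} u≢v =
    subst (_≤ 1) (sum-cong-≗ λ x → 𝟙-∧ (lookup (B u) x) (lookup (B v) x)) (∑𝟙≤1 common unique)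
    where
    common : Fin n → Bool
    common x = lookup (B u) x ∧ lookup (B v) x
    two-blocks : ∀ {x y} → x ≢ y → common x ≡ true → common y ≡ true →
      ¬ (incidence u x * incidence u y + incidence v x * incidence v y ≤ pairs x y)
    two-blocks {x} {y} x≢y cx cy ≤pairs =
      contradiction (subst₂ _≤_ both-blocks (pairs-≢ x≢y) ≤pairs) λ { (s≤s ()) }
      where
      in-block : ∀ {a b} → a ∧ b ≡ true → 𝟙[ a ] ≡ 1 × 𝟙[ b ] ≡ 1
      in-block {a} {b} ab = cong 𝟙[_] (∧-conicalˡ a b ab) , cong 𝟙[_] (∧-conicalʳ a b ab)
      both-blocks : incidence u x * incidence u y + incidence v x * incidence v y ≡ 2
      both-blocks with in-block {lookup (B u) x} cx | in-block {lookup (B u) y} cy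
      ... | ux , vx | uy , vy = cong₂ _+_ (cong₂ _*_ ux uy) (cong₂ _*_ vx vy)
    unique : ∀ {x y} → common x ≡ true → common y ≡ true → x ≡ y
    unique {x} {y} cx cy with x ≟ y
    ... | yes x≡y = x≡y
    ... | no  x≢y =
      contradiction (pair≤∑ (λ w → incidence w x * incidence w y) u≢v) (two-blocks x≢y cx cy)

  adj-irrefl : ∀ v → adj B v v ≡ false
  adj-irrefl v with v ≟ v
  ... | yes _   = refl
  ... | no  v≢v = contradiction refl v≢v

  𝟙-adj : ∀ {u v} → u ≢ v → 𝟙[ adj B u v ] ≡ meet u v
  𝟙-adj {u} {v} u≢v with u ≟ v
  ... | yes u≡v = contradiction u≡v u≢v
  ... | no  _   = trans (cong (λ k → 𝟙[ 1 ≤ᵇ k ]) (∣p∩q∣≡∑ (B u) (B v))) (𝟙-≤ᵇ (meet≤1 u≢v))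

  blockSum-const : ∀ {f c} → (∀ y → f y ≡ c) → ∀ v → blockSum f v ≡ 3 * c
  blockSum-const {f} {c} f≡c v = begin
    ∑[ y < n ] (incidence v y * f y)  ≡⟨ sum-cong-≗ (λ y → cong (incidence v y *_) (f≡c y)) ⟩
    ∑[ y < n ] (incidence v y * c)    ≡⟨ *-distribʳ-sum c (incidence v) ⟨
    ∑[ y < n ] incidence v y * c      ≡⟨ cong (_* c) (blockSize v) ⟩
    3 * c                             ∎
    where open ≡-Reasoning

  blockSums-through : ∀ f x →
    ∑[ v < m ] (incidence v x * blockSum f v) + f x ≡ sum f + f x * replication x
  blockSums-through f x = begin
    ∑[ v < m ] (incidence v x * blockSum f v) + f x
      ≡⟨ cong (_+ f x) (∑-transpose incidence (λ v → incidence v x) f) ⟨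
    ∑[ y < n ] (f y * pairs x y) + f x              ≡⟨ ∑-agreeExcept x off-diagonal ⟩
    sum f + f x * pairs x x                         ≡⟨ cong (λ k → sum f + f x * k) (pairs-diag x) ⟩
    sum f + f x * replication x                     ∎
    where
    open ≡-Reasoning
    off-diagonal : ∀ y → y ≢ x → f y * pairs x y ≡ f y
    off-diagonal y y≢x = trans (cong (f y *_) (pairs-≢ (y≢x ∘ sym))) (*-identityʳ (f y))

  replication-formula : ∀ x → 1 + 2 * replication x ≡ n
  replication-formula x = +-cancelˡ-≡ r _ _ (begin
    r + (1 + 2 * r)                                       ≡⟨ regroup r ⟩
    r * 3 + 1                                             ≡⟨ cong (_+ 1) (*-distribʳ-sum 3 (λ v → incidence v x)) ⟩
    ∑[ v < m ] (incidence v x * 3) + 1                    ≡⟨ cong (_+ 1) (sum-cong-≗ λ v → cong (incidence v x *_) (blockSum-const (λ _ → refl) v)) ⟨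
    ∑[ v < m ] (incidence v x * blockSum (λ _ → 1) v) + 1 ≡⟨ blockSums-through (λ _ → 1) x ⟩
    ∑[ y < n ] 1 + 1 * r                                  ≡⟨ cong₂ _+_ (∑-one n) (*-identityˡ r) ⟩
    n + r                                                 ≡⟨ +-comm n r ⟩
    r + n                                                 ∎)
    where
    open ≡-Reasoning
    r : ℕ
    r = replication x
    regroup : ∀ r → r + (1 + 2 * r) ≡ r * 3 + 1
    regroup = solve-∀

  replication-constant : Constant replication
  replication-constant x y =
    *-cancelˡ-≡ _ _ 2 (suc-injective (trans (replication-formula x) (sym (replication-formula y))))

  2≤replication : ∀ {u v} → u ≢ v → ∀ x → 2 ≤ replication x
  2≤replication {u} {v} u≢v x with replication x | replication-formula x
  ... | 0           | 1≡n = contradiction (subst (3 ≤_) (sym 1≡n) 3≤n) λ { (s≤s ()) }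
    where
    3≤n : 3 ≤ n
    3≤n = subst (_≤ n) (triples u) (∣p∣≤n (B u))
  ... | 1           | 3≡n = contradiction (distinct (trans (whole u) (sym (whole v)))) u≢v
    where
    whole : ∀ w → B w ≡ ⊤
    whole w = ∣p∣≡n⇒p≡⊤ (trans (triples w) 3≡n)
  ... | suc (suc _) | _   = s≤s (s≤s z≤n)

  constant⇒constant-blockSums : ∀ {f} → Constant f → Constant (blockSum f)
  constant⇒constant-blockSums {f} const v w =
    trans (blockSum-const (λ y → const y x) v) (sym (blockSum-const (λ y → const y x) w))
    where
    x : Fin n
    x = pointOf v

  -- Weighting the pairs (point y, block through x and y) by f gives (r − 1)·f x + Σ f = r·s.
  constant-blockSums⇒constant : ∀ {f u v} → u ≢ v → Constant (blockSum f) → Constant f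
  constant-blockSums⇒constant {f} {u} u≢v const x y =
    affine-injective (2≤replication u≢v x) (through x) (through y)
    where
    s : ℕ
    s = blockSum f u
    through : ∀ z → replication x * s + f z ≡ sum f + f z * replication x
    through z = begin
      replication x * s + f z                         ≡⟨ cong (λ r → r * s + f z) (replication-constant x z) ⟩
      replication z * s + f z                         ≡⟨ cong (_+ f z) (*-distribʳ-sum s (λ v → incidence v z)) ⟩
      ∑[ v < m ] (incidence v z * s) + f z            ≡⟨ cong (_+ f z) (sum-cong-≗ λ v → cong (incidence v z *_) (const v u)) ⟨
      ∑[ v < m ] (incidence v z * blockSum f v) + f z ≡⟨ blockSums-through f z ⟩
      sum f + f z * replication z                     ≡⟨ cong (λ r → sum f + f z * r) (replication-constant z x) ⟩
      sum f + f z * replication x                     ∎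
      where open ≡-Reasoning

  neighbours : ∀ D v → ∣ N B v ∩ D ∣ + 𝟙[ lookup D v ] * 3 ≡ blockSum (degree D) v
  neighbours D v = begin
    ∣ N B v ∩ D ∣ + 𝟙[ lookup D v ] * 3
      ≡⟨ cong₂ _+_ (∣p∩q∣≡∑ (N B v) D) (cong (𝟙[ lookup D v ] *_) (sym (meet-diag v))) ⟩
    sum adjacentIn + 𝟙[ lookup D v ] * meet v v   ≡⟨ ∑-agreeExcept v (λ u u≢v → sym (off-diagonal u u≢v)) ⟨
    sum weighted + adjacentIn v                   ≡⟨ cong (sum weighted +_) not-self-adjacent ⟩
    sum weighted + 0                              ≡⟨ +-identityʳ (sum weighted) ⟩
    sum weighted                                  ≡⟨ ∑-transpose incidence (λ u → 𝟙[ lookup D u ]) (incidence v) ⟨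
    blockSum (degree D) v                         ∎
    where
    open ≡-Reasoning
    adjacentIn weighted : Fin m → ℕ
    adjacentIn u = 𝟙[ lookup (N B v) u ] * 𝟙[ lookup D u ]
    weighted u = 𝟙[ lookup D u ] * meet u v
    off-diagonal : ∀ u → u ≢ v → adjacentIn u ≡ weighted u
    off-diagonal u u≢v = begin
      𝟙[ lookup (N B v) u ] * 𝟙[ lookup D u ] ≡⟨ cong (λ b → 𝟙[ b ] * 𝟙[ lookup D u ]) (lookup∘tabulate (adj B v) u) ⟩
      𝟙[ adj B v u ] * 𝟙[ lookup D u ]        ≡⟨ cong (_* 𝟙[ lookup D u ]) (trans (𝟙-adj (u≢v ∘ sym)) (meet-comm v u)) ⟩
      meet u v * 𝟙[ lookup D u ]              ≡⟨ *-comm (meet u v) _ ⟩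
      𝟙[ lookup D u ] * meet u v              ∎
    not-self-adjacent : adjacentIn v ≡ 0
    not-self-adjacent =
      cong (λ b → 𝟙[ b ] * 𝟙[ lookup D v ]) (trans (lookup∘tabulate (adj B v) v) (adj-irrefl v))

  neighbours-∈ : ∀ {D v} → v ∈ D → ∣ N B v ∩ D ∣ + 3 ≡ blockSum (degree D) v
  neighbours-∈ {D} {v} v∈D =
    subst (λ b → ∣ N B v ∩ D ∣ + 𝟙[ b ] * 3 ≡ blockSum (degree D) v) ([]=⇒lookup v∈D) (neighbours D v)

  neighbours-∉ : ∀ {D v} → v ∉ D → ∣ N B v ∩ D ∣ ≡ blockSum (degree D) v
  neighbours-∉ {D} {v} v∉D = trans (sym (+-identityʳ ∣ N B v ∩ D ∣))
    (subst (λ b → ∣ N B v ∩ D ∣ + 𝟙[ b ] * 3 ≡ blockSum (degree D) v) (x∉p⇒lookup≡false v∉D) (neighbours D v))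

  neighbours-∈-constant : ∀ {D u v} → Constant (blockSum (degree D)) → u ∈ D → v ∈ D →
    ∣ N B u ∩ D ∣ ≡ ∣ N B v ∩ D ∣
  neighbours-∈-constant const u∈D v∈D =
    +-cancelʳ-≡ 3 _ _ (trans (neighbours-∈ u∈D) (trans (const _ _) (sym (neighbours-∈ v∈D))))

  neighbours-∉-constant : ∀ {D u v} → Constant (blockSum (degree D)) → u ∉ D → v ∉ D →
    ∣ N B u ∩ D ∣ ≡ ∣ N B v ∩ D ∣
  neighbours-∉-constant const u∉D v∉D =
    trans (neighbours-∉ u∉D) (trans (const _ _) (sym (neighbours-∉ v∉D)))

  degree-∁ : ∀ D x → degree D x + degree (∁ D) x ≡ replication x
  degree-∁ D x =
    trans (sym (∑-distrib-+ (λ u → 𝟙[ lookup D u ] * incidence u x) (λ u → 𝟙[ lookup (∁ D) u ] * incidence u x)))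
          (sum-cong-≗ λ u → split (lookup D u) (incidence u x) (lookup-map u not D))
    where
    split : ∀ b {c} k → c ≡ not b → 𝟙[ b ] * k + 𝟙[ c ] * k ≡ k
    split true  k refl = trans (+-identityʳ (1 * k)) (*-identityˡ k)
    split false k refl = *-identityˡ k

  blockWeight-total : ∀ D v → blockSum (degree D) v + blockSum (degree (∁ D)) v ≡ blockSum replication v
  blockWeight-total D v = begin
    blockSum (degree D) v + blockSum (degree (∁ D)) v
      ≡⟨ ∑-distrib-+ (λ y → incidence v y * degree D y) _ ⟨
    ∑[ y < n ] (incidence v y * degree D y + incidence v y * degree (∁ D) y)
      ≡⟨ sum-cong-≗ (λ y → *-distribˡ-+ (incidence v y) _ _) ⟨
    ∑[ y < n ] (incidence v y * (degree D y + degree (∁ D) y))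
      ≡⟨ sum-cong-≗ (λ y → cong (incidence v y *_) (degree-∁ D y)) ⟩
    blockSum replication v
      ∎
    where open ≡-Reasoning

  constant-blockWeight-∁ : ∀ {D} → Constant (blockSum (degree D)) → Constant (blockSum (degree (∁ D)))
  constant-blockWeight-∁ {D} const u v = +-cancelˡ-≡ (blockSum (degree D) u) _ _ (begin
    blockSum (degree D) u + blockSum (degree (∁ D)) u ≡⟨ blockWeight-total D u ⟩
    blockSum replication u                            ≡⟨ constant⇒constant-blockSums replication-constant u v ⟩
    blockSum replication v                            ≡⟨ blockWeight-total D v ⟨
    blockSum (degree D) v + blockSum (degree (∁ D)) v ≡⟨ cong (_+ blockSum (degree (∁ D)) v) (const v u) ⟩
    blockSum (degree D) u + blockSum (degree (∁ D)) v ∎)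
    where open ≡-Reasoning

  design-count≡degree : ∀ D x → ∣ tabulate (λ u → lookup D u ∧ lookup (B u) x) ∣ ≡ degree D x
  design-count≡degree D x = trans (∣tabulate∣≡∑ (λ u → lookup D u ∧ lookup (B u) x))
                                  (sum-cong-≗ λ u → 𝟙-∧ (lookup D u) (lookup (B u) x))

  oneDesign⇒constant-degree : ∀ {D} → OneDesign B D → Constant (degree D)
  oneDesign⇒constant-degree {D} (_ , count≡λ) x y =
    trans (sym (design-count≡degree D x)) (trans (count≡λ x) (trans (sym (count≡λ y)) (design-count≡degree D y)))

  constant-degree⇒oneDesign : ∀ {D} → Fin n → Constant (degree D) → OneDesign B D
  constant-degree⇒oneDesign {D} x₀ const = degree D x₀ , λ x → trans (design-count≡degree D x) (const x x₀)

  CRC₁⇒constant-blockWeight : ∀ {C v₀} → v₀ ∈ C → CRC₁WithEigenvalue B C θ₂ → Constant (blockSum (degree C))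
  CRC₁⇒constant-blockWeight {C} {v₀} v₀∈C (α₀ , β₀ , γ₁ , α₁ , crc , eigenvalue) u v = trans (weight u) (sym (weight v))
    where
    open IsCRC₁ crc
    v₁ : Fin m
    v₁ = proj₁ C₁-nonempty
    v₁∉C : v₁ ∉ C
    v₁∉C = proj₂ C₁-nonempty
    row₀ : α₀ + 3 + β₀ ≡ blockSum replication v₀
    row₀ = trans (cong₂ _+_ (trans (cong (_+ 3) (sym (α₀-ok v₀ v₀∈C))) (neighbours-∈ v₀∈C))
                           (trans (sym (β₀-ok v₀ v₀∈C)) (neighbours-∉ (x∈p⇒x∉∁p v₀∈C))))
                 (blockWeight-total C v₀)
    row₁ : γ₁ + (α₁ + 3) ≡ blockSum replication v₀
    row₁ = trans (cong₂ _+_ (trans (sym (γ₁-ok v₁ v₁∉C)) (neighbours-∉ v₁∉C))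
                           (trans (cong (_+ 3) (sym (α₁-ok v₁ v₁∉C))) (neighbours-∈ (x∉p⇒x∈∁p v₁∉C))))
                 (trans (blockWeight-total C v₁) (constant⇒constant-blockSums replication-constant v₁ v₀))
    α₀+3≡γ₁ : α₀ + 3 ≡ γ₁
    α₀+3≡γ₁ = equal-row-sums (≤-trans (s≤s z≤n) (m≤n+m 3 α₀)) (trans row₀ (sym row₁))
                (Equivalence.to (θ₂-eigenvalue⇔ α₀ β₀ γ₁ α₁) eigenvalue)
    weight : ∀ w → blockSum (degree C) w ≡ α₀ + 3
    weight w with w ∈? C
    ... | yes w∈C = trans (sym (neighbours-∈ w∈C)) (cong (_+ 3) (α₀-ok w w∈C))
    ... | no  w∉C = trans (sym (neighbours-∉ w∉C)) (trans (γ₁-ok w w∉C) (sym α₀+3≡γ₁))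

  constant-blockWeight⇒CRC₁ : ∀ {C v₀ v₁} → v₀ ∈ C → v₁ ∉ C → Constant (blockSum (degree C)) → CRC₁WithEigenvalue B C θ₂
  constant-blockWeight⇒CRC₁ {C} {v₀} {v₁} v₀∈C v₁∉C weight =
    α₀ , β₀ , γ₁ , α₁ , crc , Equivalence.from (θ₂-eigenvalue⇔ α₀ β₀ γ₁ α₁) det
    where
    α₀ β₀ γ₁ α₁ : ℕ
    α₀ = ∣ N B v₀ ∩ C ∣
    β₀ = ∣ N B v₀ ∩ ∁ C ∣
    γ₁ = ∣ N B v₁ ∩ C ∣
    α₁ = ∣ N B v₁ ∩ ∁ C ∣
    weight∁ : Constant (blockSum (degree (∁ C)))
    weight∁ = constant-blockWeight-∁ {C} weight
    v₀∉∁C : v₀ ∉ ∁ C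
    v₀∉∁C = x∈p⇒x∉∁p v₀∈C
    v₁∈∁C : v₁ ∈ ∁ C
    v₁∈∁C = x∉p⇒x∈∁p v₁∉C
    det : (α₀ + 3) * (α₁ + 3) ≡ β₀ * γ₁
    det = trans (cong₂ _*_ (trans (neighbours-∈ v₀∈C) (trans (weight v₀ v₁) (sym (neighbours-∉ v₁∉C))))
                           (trans (neighbours-∈ v₁∈∁C) (trans (weight∁ v₁ v₀) (sym (neighbours-∉ v₀∉∁C)))))
                (*-comm γ₁ β₀)
    adjacent-to-C : ∀ v → v ∉ C → ∃ λ u → u ∈ C × adj B v u ≡ true
    adjacent-to-C v v∉C with 1≤∣p∣⇒Nonempty (N B v ∩ C) (subst (1 ≤_) (sym (neighbours-∉ v∉C)) 1≤weight)
      where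
      1≤weight : 1 ≤ blockSum (degree C) v
      1≤weight = subst (1 ≤_) (trans (neighbours-∈ v₀∈C) (weight v₀ v)) (≤-trans (s≤s z≤n) (m≤n+m 3 α₀))
    ... | u , u∈N∩C with x∈p∩q⁻ (N B v) C u∈N∩C
    ... | u∈N , u∈C = u , u∈C , trans (sym (lookup∘tabulate (adj B v) u)) ([]=⇒lookup u∈N)
    crc : IsCRC₁ B C α₀ β₀ γ₁ α₁
    crc = record
      { C₁-nonempty = v₁ , v₁∉C
      ; C₁-dist1    = adjacent-to-C
      ; α₀-ok = λ v v∈C → neighbours-∈-constant weight v∈C v₀∈C
      ; β₀-ok = λ v v∈C → neighbours-∉-constant weight∁ (x∈p⇒x∉∁p v∈C) v₀∉∁C
      ; γ₁-ok = λ v v∉C → neighbours-∉-constant weight v∉C v₁∉C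
      ; α₁-ok = λ v v∉C → neighbours-∈-constant weight∁ (x∉p⇒x∈∁p v∉C) v₁∈∁C
      }

proposition3 : (n m : ℕ) (B : Fin m → Subset n) → IsSTS B →
    (C : Subset m) → Nonempty C → C ≢ ⊤ →
    (CRC₁WithEigenvalue B C θ₂ ⇔ OneDesign B C)
proposition3 n m B sts C (v₀ , v₀∈C) C≢⊤ with p≢⊤⇒∃∉ C≢⊤
... | v₁ , v₁∉C = mk⇔
  (λ crc → constant-degree⇒oneDesign {C} (pointOf v₀)
             (constant-blockSums⇒constant v₀≢v₁ (CRC₁⇒constant-blockWeight v₀∈C crc)))
  (λ design → constant-blockWeight⇒CRC₁ v₀∈C v₁∉C
                (constant⇒constant-blockSums (oneDesign⇒constant-degree {C} design)))
  where
  open SteinerTripleSystem B sts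
  v₀≢v₁ : v₀ ≢ v₁
  v₀≢v₁ refl = v₁∉C v₀∈C
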